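{- Every graph with no $K_{2,3}$ minor is a quasi-hamiltonian pseudo-outerplanar graph. Moreover, some quasi-hamiltonian pseudo-outerplanar graph has a $K_{2,3}$ minor. In symbols, $\mathcal{M}_{2,3}\subsetneq\mathcal{P}_H$.
   Context: All graphs are finite, simple and undirected. A block is a maximal 2-connected subgraph; bridges are blocks too. A graph is pseudo-outerplanar if each of its blocks can be drawn in the plane so that its vertices lie on a fixed circle, its edges lie inside the disk bounded by that circle, and each edge crosses at most one other edge. A graph is quasi-hamiltonian if each of its blocks is hamiltonian; blocks that are single edges or single vertices count as hamiltonian. $\mathcal{M}_{2,3}$ is the class of $K_{2,3}$-minor-free graphs. $\mathcal{P}_H$ is the class of quasi-hamiltonian pseudo-outerplanar graphs. -}

module Defs where

open import Data.Nat using (ℕ; zero; suc; _≤_)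
open import Data.Fin using (Fin; zero; suc; toℕ; fromℕ; _<_)
open import Data.Fin.Subset using (Subset; _∈_; _∉_; _⊆_; _-_; ∣_∣; Nonempty)
open import Data.Bool using (Bool; true; false)
open import Data.Product using (Σ; ∃; _×_; _,_)
open import Data.Sum using (_⊎_)
open import Relation.Binary.PropositionalEquality using (_≡_; _≢_)
open import Relation.Nullary using (¬_)
open import Function.Definitions using (Injective)

record Graph (n : ℕ) : Set where
  field
    adj     : Fin n → Fin n → Bool
    adj-sym : ∀ x y → adj x y ≡ adj y x
    adj-irr : ∀ x → adj x x ≡ false

open Graph public

module _ {n : ℕ} (G : Graph n) where

  Edge : Fin n → Fin n → Set
  Edge x y = adj G x y ≡ true

  data WalkIn (S : Subset n) : Fin n → Fin n → Set where
    here : ∀ {v} → v ∈ S → WalkIn S v v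
    step : ∀ {u w v} → u ∈ S → Edge u w → WalkIn S w v → WalkIn S u v

  ConnectedIn : Subset n → Set
  ConnectedIn S = ∀ u v → u ∈ S → v ∈ S → WalkIn S u v

  -- G[S] is nonempty, connected and has no cut vertex
  -- (this includes K1 and K2, so bridges and isolated vertices give blocks)
  Biconnected : Subset n → Set
  Biconnected S = Nonempty S × ConnectedIn S × (∀ x → x ∈ S → ConnectedIn (S - x))

  IsBlock : Subset n → Set
  IsBlock S = Biconnected S × (∀ T → S ⊆ T → Biconnected T → T ⊆ S)

  Enumerates : (S : Subset n) (k : ℕ) → (Fin k → Fin n) → Set
  Enumerates S k c = Injective _≡_ _≡_ c × (∀ v → v ∈ S → ∃ λ i → c i ≡ v)
                     × (∀ i → c i ∈ S)

  HamCycle : Subset n → Set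
  HamCycle S = Σ ℕ λ m → Σ (Fin (suc (suc (suc m))) → Fin n) λ c →
    Enumerates S (suc (suc (suc m))) c ×
    (∀ i j → toℕ j ≡ suc (toℕ i) → Edge (c i) (c j)) ×
    Edge (c (fromℕ (suc (suc m)))) (c zero)

  HamiltonianIn : Subset n → Set
  HamiltonianIn S = ∣ S ∣ ≤ 2 ⊎ HamCycle S

  -- chords (i,j) and (k,l) of a convex drawing (i<j, k<l positions on the circle) cross
  Interleaved : ∀ {k} → Fin k → Fin k → Fin k → Fin k → Set
  Interleaved i j a b = (i < a × a < j × j < b) ⊎ (a < i × i < b × b < j)

  -- G[S] has a drawing with all vertices on a circle (cyclic order c),
  -- edges inside the disk, every edge crossing at most one other edge
  PseudoOuterplanarIn : Subset n → Set
  PseudoOuterplanarIn S = Σ ℕ λ k → Σ (Fin k → Fin n) λ c → Enumerates S k c ×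
    (∀ i j a b a' b' → i < j → a < b → a' < b' →
       Edge (c i) (c j) → Edge (c a) (c b) → Edge (c a') (c b') →
       Interleaved i j a b → Interleaved i j a' b' → (a ≡ a' × b ≡ b'))

  QuasiHamiltonian : Set
  QuasiHamiltonian = ∀ S → IsBlock S → HamiltonianIn S

  PseudoOuterplanar : Set
  PseudoOuterplanar = ∀ S → IsBlock S → PseudoOuterplanarIn S

record MinorModel {m n : ℕ} (H : Graph m) (G : Graph n) : Set where
  field
    branch      : Fin m → Subset n
    nonempty    : ∀ v → Nonempty (branch v)
    connected   : ∀ v → ConnectedIn G (branch v)
    disjoint    : ∀ u v x → u ≢ v → x ∈ branch u → x ∉ branch v
    edges       : ∀ u v → Edge H u v →
                  ∃ λ x → ∃ λ y → x ∈ branch u × y ∈ branch v × Edge G x y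

HasMinor : ∀ {m n} → Graph m → Graph n → Set
HasMinor H G = MinorModel H G

side : Fin 5 → Bool
side zero = false
side (suc zero) = false
side (suc (suc _)) = true

k23adj : Fin 5 → Fin 5 → Bool
k23adj x y with side x | side y
... | false | true  = true
... | true  | false = true
... | _     | _     = false

K23 : Graph 5
K23 = record { adj = k23adj ; adj-sym = sym' ; adj-irr = irr }
  where
  sym' : ∀ x y → k23adj x y ≡ k23adj y x
  sym' x y with side x | side y
  ... | false | false = _≡_.refl
  ... | false | true  = _≡_.refl
  ... | true  | false = _≡_.refl
  ... | true  | true  = _≡_.refl
  irr : ∀ x → k23adj x x ≡ false
  irr x with side x
  ... | false = _≡_.refl
  ... | true  = _≡_.refl

InPH : ∀ {n} → Graph n → Set
InPH G = QuasiHamiltonian G × PseudoOuterplanar G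

{-# OPTIONS --safe #-}
module Submission where

open import Defs
open import Data.Nat using (ℕ; zero; suc; _+_; _≤_; _<_; _≤?_; z≤n; s≤s)
open import Data.Nat.Properties
  using (≤-refl; ≤-trans; <⇒≤; ≰⇒>; +-suc; +-identityʳ; +-mono-≤; <-irrefl; m≤n⇒m≤1+n; suc-injective)
open import Data.Bool using (Bool; true; false; _∨_)
import Data.Bool.Properties as Bool
open import Data.Fin using (Fin; zero; suc; toℕ; fromℕ) renaming (_<_ to _<ᶠ_)
open import Data.Fin.Properties using (toℕ-injective; toℕ<n; pigeonhole; any?; all?; _<?_; <⇒≢) renaming (_≟_ to _≟ᶠ_)
open import Data.Fin.Subset using (Subset; _∈_; _∉_; _⊆_; _-_; _─_; _∪_; ⋃; ⁅_⁆; ⊤; ∣_∣; Nonempty; inside; outside)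
import Data.Fin.Subset as Subset
open import Data.Fin.Subset.Properties
  using (_∈?_; x∈p∪q⁻; x∈p∪q⁺; x∈⁅y⁆⇒x≡y; x∈⁅x⁆; ∉⊥; ∈⊤; p─q⊆p; x∈p∧x≢y⇒x∈p-y; p⊆q⇒∣p∣≤∣q∣; ∣⊥∣≡0)
open import Data.Vec using ([]; _∷_)
import Data.Vec as Vec
open import Data.List using (List; []; _∷_; _++_; [_]; length; lookup; concat; reverse; map)
open import Data.List.Properties using (++-assoc; ++-identityʳ; length-++-comm; length-++-≤ʳ; unfold-reverse; reverse-++)
open import Data.List.Relation.Unary.Any using (here; there; index)
open import Data.List.Relation.Unary.Any.Properties using (lookup-index; reverse⁺; reverse⁻)
open import Data.List.Membership.Propositional using () renaming (_∈_ to _∈ₗ_; _∉_ to _∉ₗ_)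
open import Data.List.Membership.Propositional.Properties using (∈-++⁺ˡ; ∈-++⁺ʳ; ∈-++⁻; ∈-∃++; ∈-lookup; ∈-concat⁺′)
import Data.List.Membership.DecPropositional as DecMembership
open import Data.Product using (Σ; ∃; ∃₂; _×_; _,_; proj₁; proj₂)
open import Data.Sum using (_⊎_; inj₁; inj₂; [_,_]′)
open import Data.Empty using (⊥; ⊥-elim)
open import Function using (_∘_)
open import Relation.Binary.PropositionalEquality using (_≡_; _≢_; refl; sym; trans; cong; subst; subst₂)
open import Relation.Nullary using (¬_; yes; no; Dec)
open import Relation.Nullary.Decidable using (_×-dec_; _⊎-dec_; _→-dec_; ¬?; toWitness)

-- In a block of a K_{2,3}-minor-free graph, grow a cycle by ears. By 2-connectivity every vertex
-- off the current cycle C lies on an ear: a path outside C joining two distinct vertices x, y of C.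
-- If x and y were not consecutive on C, the two arcs of C and the ear would be three internally
-- disjoint x–y paths with nonempty interiors, a K_{2,3} subdivision; so the ear lengthens C.
-- Starting from an edge, traversed as a degenerate 2-cycle, this ends in a hamiltonian cycle.
-- Place the block on a circle in hamiltonian order. With five or more vertices two crossing
-- chords pr, qs leave some nonempty arc between consecutive ends, and again give a K_{2,3} model,
-- so the drawing is even outerplanar; with at most four positions a chord crosses at most one
-- other. For strictness, K_{2,3} plus an edge inside its larger side is drawn in the order
-- 0,2,1,3,4 with a single crossing.

module _ {A : Set} where

  data Uniq : List A → Set where
    []  : Uniq []
    _∷_ : ∀ {x xs} → x ∉ₗ xs → Uniq xs → Uniq (x ∷ xs)

  Disjoint : List A → List A → Set
  Disjoint xs ys = ∀ {z} → z ∈ₗ xs → z ∈ₗ ys → ⊥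

  Inhabited : List A → Set
  Inhabited xs = ∃ λ z → z ∈ₗ xs

  uniq-++⁻ : ∀ xs {ys} → Uniq (xs ++ ys) → Uniq xs × Uniq ys × Disjoint xs ys
  uniq-++⁻ [] u = [] , u , λ ()
  uniq-++⁻ (x ∷ xs) {ys} (x∉ ∷ u) with uniq-++⁻ xs u
  ... | uxs , uys , disj = (x∉ ∘ ∈-++⁺ˡ) ∷ uxs , uys , disj′
    where
    disj′ : Disjoint (x ∷ xs) ys
    disj′ (here refl) = x∉ ∘ ∈-++⁺ʳ xs
    disj′ (there m)   = disj m

  uniq-++⁺ : ∀ xs {ys} → Uniq xs → Uniq ys → Disjoint xs ys → Uniq (xs ++ ys)
  uniq-++⁺ [] _ u _ = u
  uniq-++⁺ (x ∷ xs) (x∉ ∷ uxs) uys disj =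
    (λ m → [ x∉ , disj (here refl) ]′ (∈-++⁻ xs m)) ∷ uniq-++⁺ xs uxs uys (disj ∘ there)

  uniq-++-comm : ∀ xs {ys} → Uniq (xs ++ ys) → Uniq (ys ++ xs)
  uniq-++-comm xs {ys} u with uniq-++⁻ xs u
  ... | uxs , uys , disj = uniq-++⁺ ys uys uxs (λ m m′ → disj m′ m)

  ∈-++-comm : ∀ xs {ys} {z : A} → z ∈ₗ xs ++ ys → z ∈ₗ ys ++ xs
  ∈-++-comm xs {ys} m = [ ∈-++⁺ʳ ys , ∈-++⁺ˡ ]′ (∈-++⁻ xs m)

  uniq-reverse : ∀ xs → Uniq xs → Uniq (reverse xs)
  uniq-reverse [] u = u
  uniq-reverse (x ∷ xs) (x∉ ∷ u) =
    subst Uniq (sym (unfold-reverse x xs))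
      (uniq-++⁺ (reverse xs) (uniq-reverse xs u) ((λ ()) ∷ [])
        (λ { m (here refl) → x∉ (reverse⁻ m) }))

  concat-disjoint : ∀ (xss : List (List A)) → Uniq (concat xss) →
                    ∀ i j → i ≢ j → Disjoint (lookup xss i) (lookup xss j)
  concat-disjoint (xs ∷ xss) u zero zero i≢j = ⊥-elim (i≢j refl)
  concat-disjoint (xs ∷ xss) u zero (suc j) _ m m′ =
    proj₂ (proj₂ (uniq-++⁻ xs u)) m (∈-concat⁺′ m′ (∈-lookup {xs = xss} j))
  concat-disjoint (xs ∷ xss) u (suc i) zero _ m m′ =
    proj₂ (proj₂ (uniq-++⁻ xs u)) m′ (∈-concat⁺′ m (∈-lookup {xs = xss} i))
  concat-disjoint (xs ∷ xss) u (suc i) (suc j) i≢j =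
    concat-disjoint xss (proj₁ (proj₂ (uniq-++⁻ xs u))) i j (i≢j ∘ cong suc)

  lookup-injective : ∀ xs → Uniq xs → ∀ (i j : Fin (length xs)) → lookup xs i ≡ lookup xs j → i ≡ j
  lookup-injective (x ∷ xs) u zero zero eq = refl
  lookup-injective (x ∷ xs) (x∉ ∷ u) zero (suc j) eq = ⊥-elim (x∉ (subst (_∈ₗ xs) (sym eq) (∈-lookup j)))
  lookup-injective (x ∷ xs) (x∉ ∷ u) (suc i) zero eq = ⊥-elim (x∉ (subst (_∈ₗ xs) eq (∈-lookup i)))
  lookup-injective (x ∷ xs) (x∉ ∷ u) (suc i) (suc j) eq = cong suc (lookup-injective xs u i j eq)

uniq-length≤ : ∀ {n} (xs : List (Fin n)) → Uniq xs → length xs ≤ n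
uniq-length≤ {n} xs u with length xs ≤? n
... | yes h = h
... | no h with pigeonhole (≰⇒> h) (lookup xs)
...   | i , j , i<j , eq = ⊥-elim (<⇒≢ i<j (lookup-injective xs u i j eq))

module _ {A : Set} where

  marked4 : A → List A → A → List A → A → List A → A → List A → List A
  marked4 p Q q R r T s U = p ∷ Q ++ q ∷ R ++ r ∷ T ++ s ∷ U

  marked4-++ : ∀ p Q q R r T s U X → marked4 p Q q R r T s U ++ X ≡ marked4 p Q q R r T s (U ++ X)
  marked4-++ p Q q R r T s U X
    rewrite ++-assoc Q (q ∷ R ++ r ∷ T ++ s ∷ U) X
          | ++-assoc R (r ∷ T ++ s ∷ U) X
          | ++-assoc T (s ∷ U) X = refl

  lookup-split : ∀ (L : List A) (b : Fin (length L)) → ∃₂ λ T U → L ≡ T ++ lookup L b ∷ U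
  lookup-split (x ∷ L) zero = [] , L , refl
  lookup-split (x ∷ L) (suc b) with lookup-split L b
  ... | T , U , eq = x ∷ T , U , cong (x ∷_) eq

  lookup-split₂ : ∀ (L : List A) (j b : Fin (length L)) → toℕ j < toℕ b →
                  Σ (List A) λ R → ∃₂ λ T U → L ≡ R ++ lookup L j ∷ T ++ lookup L b ∷ U
  lookup-split₂ (x ∷ L) zero (suc b) _ with lookup-split L b
  ... | T , U , eq = [] , T , U , cong (x ∷_) eq
  lookup-split₂ (x ∷ L) (suc j) (suc b) (s≤s j<b) with lookup-split₂ L j b j<b
  ... | R , T , U , eq = x ∷ R , T , U , cong (x ∷_) eq

  lookup-split₃ : ∀ (L : List A) (a j b : Fin (length L)) → toℕ a < toℕ j → toℕ j < toℕ b →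
                  Σ (List A) λ Q → Σ (List A) λ R → ∃₂ λ T U →
                  L ≡ Q ++ lookup L a ∷ R ++ lookup L j ∷ T ++ lookup L b ∷ U
  lookup-split₃ (x ∷ L) zero (suc j) (suc b) _ (s≤s j<b) with lookup-split₂ L j b j<b
  ... | R , T , U , eq = [] , R , T , U , cong (x ∷_) eq
  lookup-split₃ (x ∷ L) (suc a) (suc j) (suc b) (s≤s a<j) (s≤s j<b) with lookup-split₃ L a j b a<j j<b
  ... | Q , R , T , U , eq = x ∷ Q , R , T , U , cong (x ∷_) eq

  lookup-split₄ : ∀ (L : List A) (i a j b : Fin (length L)) → toℕ i < toℕ a → toℕ a < toℕ j → toℕ j < toℕ b →
                  Σ (List A) λ P → Σ (List A) λ Q → Σ (List A) λ R → ∃₂ λ T U →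
                  L ≡ P ++ marked4 (lookup L i) Q (lookup L a) R (lookup L j) T (lookup L b) U
  lookup-split₄ (x ∷ L) zero (suc a) (suc j) (suc b) _ (s≤s a<j) (s≤s j<b) with lookup-split₃ L a j b a<j j<b
  ... | Q , R , T , U , eq = [] , Q , R , T , U , cong (x ∷_) eq
  lookup-split₄ (x ∷ L) (suc i) (suc a) (suc j) (suc b) (s≤s i<a) (s≤s a<j) (s≤s j<b)
    with lookup-split₄ L i a j b i<a a<j j<b
  ... | P , Q , R , T , U , eq = x ∷ P , Q , R , T , U , cong (x ∷_) eq

⟦_⟧ : ∀ {n} → List (Fin n) → Subset n
⟦ xs ⟧ = ⋃ (map ⁅_⁆ xs)

∈⟦⟧⁺ : ∀ {n} {z : Fin n} xs → z ∈ₗ xs → z ∈ ⟦ xs ⟧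
∈⟦⟧⁺ (x ∷ xs) (here refl) = x∈p∪q⁺ (inj₁ (x∈⁅x⁆ x))
∈⟦⟧⁺ (x ∷ xs) (there m) = x∈p∪q⁺ (inj₂ (∈⟦⟧⁺ xs m))

∈⟦⟧⁻ : ∀ {n} {z : Fin n} xs → z ∈ ⟦ xs ⟧ → z ∈ₗ xs
∈⟦⟧⁻ [] m = ⊥-elim (∉⊥ m)
∈⟦⟧⁻ (x ∷ xs) m with x∈p∪q⁻ ⁅ x ⁆ ⟦ xs ⟧ m
... | inj₁ m′ = here (x∈⁅y⁆⇒x≡y x m′)
... | inj₂ m′ = there (∈⟦⟧⁻ xs m′)

∣⊥∪p∣ : ∀ {n} (p : Subset n) → ∣ Subset.⊥ ∪ p ∣ ≡ ∣ p ∣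
∣⊥∪p∣ [] = refl
∣⊥∪p∣ (inside ∷ p) = cong suc (∣⊥∪p∣ p)
∣⊥∪p∣ (outside ∷ p) = ∣⊥∪p∣ p

∣⁅x⁆∪p∣≤1+∣p∣ : ∀ {n} (x : Fin n) (p : Subset n) → ∣ ⁅ x ⁆ ∪ p ∣ ≤ suc ∣ p ∣
∣⁅x⁆∪p∣≤1+∣p∣ zero (inside ∷ p) rewrite ∣⊥∪p∣ p = m≤n⇒m≤1+n ≤-refl
∣⁅x⁆∪p∣≤1+∣p∣ zero (outside ∷ p) rewrite ∣⊥∪p∣ p = ≤-refl
∣⁅x⁆∪p∣≤1+∣p∣ (suc x) (inside ∷ p) = s≤s (∣⁅x⁆∪p∣≤1+∣p∣ x p)
∣⁅x⁆∪p∣≤1+∣p∣ (suc x) (outside ∷ p) = ∣⁅x⁆∪p∣≤1+∣p∣ x p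

∣⟦⟧∣≤length : ∀ {n} (xs : List (Fin n)) → ∣ ⟦ xs ⟧ ∣ ≤ length xs
∣⟦⟧∣≤length {n} [] = subst (_≤ 0) (sym (∣⊥∣≡0 n)) z≤n
∣⟦⟧∣≤length (x ∷ xs) = ≤-trans (∣⁅x⁆∪p∣≤1+∣p∣ x ⟦ xs ⟧) (s≤s (∣⟦⟧∣≤length xs))

covered⇒∣S∣≤length : ∀ {n} (xs : List (Fin n)) (S : Subset n) → (∀ v → v ∈ S → v ∈ₗ xs) → ∣ S ∣ ≤ length xs
covered⇒∣S∣≤length xs S cov = ≤-trans (p⊆q⇒∣p∣≤∣q∣ (λ {v} m → ∈⟦⟧⁺ xs (cov v m))) (∣⟦⟧∣≤length xs)

x∈p─q⇒x∉q : ∀ {n} (p q : Subset n) {x} → x ∈ p ─ q → x ∉ q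
x∈p─q⇒x∉q (inside ∷ p) (outside ∷ q) Vec.here ()
x∈p─q⇒x∉q (_ ∷ p) (_ ∷ q) (Vec.there x∈) (Vec.there x∈q) = x∈p─q⇒x∉q p q x∈ x∈q

x∈p-y⇒x∈p×x≢y : ∀ {n} {x y : Fin n} {p : Subset n} → x ∈ p - y → x ∈ p × x ≢ y
x∈p-y⇒x∈p×x≢y {y = y} {p} x∈ = p─q⊆p p ⁅ y ⁆ x∈ , λ { refl → x∈p─q⇒x∉q p ⁅ y ⁆ x∈ (x∈⁅x⁆ y) }

module Paths {n : ℕ} (G : Graph n) where

  V : Set
  V = Fin n

  E : V → V → Set
  E = Edge G

  edge-sym : ∀ {x y} → E x y → E y x
  edge-sym {x} {y} e = trans (adj-sym G y x) e

  edge-irrefl : ∀ {x y} → E x y → x ≢ y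
  edge-irrefl {x} e refl with trans (sym e) (adj-irr G x)
  ... | ()

  _⊆ₛ_ : List V → Subset n → Set
  xs ⊆ₛ S = ∀ {z} → z ∈ₗ xs → z ∈ S

  EdgeBetween : List V → List V → Set
  EdgeBetween X Y = Σ V λ a → Σ V λ b → a ∈ₗ X × b ∈ₗ Y × E a b

  edgeBetween-sym : ∀ {X Y} → EdgeBetween X Y → EdgeBetween Y X
  edgeBetween-sym (a , b , a∈ , b∈ , e) = b , a , b∈ , a∈ , edge-sym e

  infixr 5 _◅_
  data Path : List V → Set where
    nil : Path []
    ⟨_⟩ : ∀ x → Path [ x ]
    _◅_ : ∀ {x y xs} → E x y → Path (y ∷ xs) → Path (x ∷ y ∷ xs)

  path-tail : ∀ {x xs} → Path (x ∷ xs) → Path xs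
  path-tail ⟨ x ⟩ = nil
  path-tail (e ◅ p) = p

  path-prefix : ∀ xs {ys} → Path (xs ++ ys) → Path xs
  path-prefix [] p = nil
  path-prefix (x ∷ []) p = ⟨ x ⟩
  path-prefix (x ∷ y ∷ xs) (e ◅ p) = e ◅ path-prefix (y ∷ xs) p

  path-suffix : ∀ xs {ys} → Path (xs ++ ys) → Path ys
  path-suffix [] p = p
  path-suffix (x ∷ xs) p = path-suffix xs (path-tail p)

  path-join : ∀ xs {y ys} → Path (xs ++ [ y ]) → Path (y ∷ ys) → Path (xs ++ y ∷ ys)
  path-join [] p q = q
  path-join (x ∷ []) (e ◅ _) q = e ◅ q
  path-join (x ∷ x′ ∷ xs) (e ◅ p) q = e ◅ path-join (x′ ∷ xs) p q

  path-split : ∀ xs {y ys} → Path (xs ++ y ∷ ys) → Path (xs ++ [ y ]) × Path (y ∷ ys)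
  path-split [] p = ⟨ _ ⟩ , p
  path-split (x ∷ []) (e ◅ p) = e ◅ ⟨ _ ⟩ , p
  path-split (x ∷ x′ ∷ xs) (e ◅ p) with path-split (x′ ∷ xs) p
  ... | p₁ , p₂ = e ◅ p₁ , p₂

  path-reverse : ∀ xs → Path xs → Path (reverse xs)
  path-reverse [] p = p
  path-reverse (x ∷ []) p = p
  path-reverse (x ∷ y ∷ ys) (e ◅ p) =
    subst Path reversed
      (path-join (reverse ys) (subst Path (unfold-reverse y ys) (path-reverse (y ∷ ys) p)) (edge-sym e ◅ ⟨ x ⟩))
    where
    reversed : reverse ys ++ y ∷ [ x ] ≡ reverse (x ∷ y ∷ ys)
    reversed = trans (sym (++-assoc (reverse ys) [ y ] [ x ]))
                 (trans (cong (_++ [ x ]) (sym (unfold-reverse y ys))) (sym (unfold-reverse x (y ∷ ys))))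

  NeighbourIn : V → List V → Set
  NeighbourIn y zs = Σ V λ z → z ∈ₗ zs × E y z

  path-neighbourʳ : ∀ y zs {ys} → Path (y ∷ zs ++ ys) → Inhabited zs → NeighbourIn y zs
  path-neighbourʳ y (z ∷ zs) (e ◅ _) _ = z , here refl , e

  path-neighbourˡ : ∀ zs {y ys} → Path (zs ++ y ∷ ys) → Inhabited zs → NeighbourIn y zs
  path-neighbourˡ (z ∷ []) (e ◅ _) _ = z , here refl , edge-sym e
  path-neighbourˡ (z ∷ z′ ∷ zs) (_ ◅ p) _ with path-neighbourˡ (z′ ∷ zs) p (z′ , here refl)
  ... | w , w∈ , e = w , there w∈ , e

  Cycle : List V → Set
  Cycle [] = ⊥
  Cycle (x ∷ xs) = Path (x ∷ xs ++ [ x ])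

  cycle-rotate : ∀ xs ys → Cycle (xs ++ ys) → Cycle (ys ++ xs)
  cycle-rotate [] ys c = subst Cycle (sym (++-identityʳ ys)) c
  cycle-rotate (x ∷ xs) [] c = subst Cycle (++-identityʳ (x ∷ xs)) c
  cycle-rotate (x ∷ xs) (y ∷ ys) c
    with path-split (x ∷ xs) (subst Path (++-assoc (x ∷ xs) (y ∷ ys) [ x ]) c)
  ... | p₁ , p₂ = subst Path (sym (++-assoc (y ∷ ys) (x ∷ xs) [ y ])) (path-join (y ∷ ys) p₂ p₁)

  walkIn-snoc : ∀ {S u v w} → WalkIn G S u v → E v w → w ∈ S → WalkIn G S u w
  walkIn-snoc (here h) e w∈ = step h e (here w∈)
  walkIn-snoc (step h e p) e′ w∈ = step h e (walkIn-snoc p e′ w∈)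

  walkIn-reverse : ∀ {S u v} → WalkIn G S u v → WalkIn G S v u
  walkIn-reverse (here h) = here h
  walkIn-reverse (step h e p) = walkIn-snoc (walkIn-reverse p) (edge-sym e) h

  walkIn-++ : ∀ {S u v w} → WalkIn G S u v → WalkIn G S v w → WalkIn G S u w
  walkIn-++ (here _) q = q
  walkIn-++ (step h e p) q = step h e (walkIn-++ p q)

  walkIn-head : ∀ {S u v} → WalkIn G S u v → u ∈ S
  walkIn-head (here h) = h
  walkIn-head (step h _ _) = h

  path⇒walkIn : ∀ {S} x xs → Path (x ∷ xs) → (x ∷ xs) ⊆ₛ S → ∀ {z} → z ∈ₗ x ∷ xs → WalkIn G S x z
  path⇒walkIn x xs p sub (here refl) = here (sub (here refl))
  path⇒walkIn x (y ∷ xs) (e ◅ p) sub (there m) = step (sub (here refl)) e (path⇒walkIn y xs p (sub ∘ there) m)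

  path-connected : ∀ {S} xs → Path xs → xs ⊆ₛ S → (∀ v → v ∈ S → v ∈ₗ xs) → ConnectedIn G S
  path-connected [] p sub cover u v u∈ v∈ with cover u u∈
  ... | ()
  path-connected (x ∷ xs) p sub cover u v u∈ v∈ =
    walkIn-++ (walkIn-reverse (path⇒walkIn x xs p sub (cover u u∈))) (path⇒walkIn x xs p sub (cover v v∈))

module K23Frames {n : ℕ} (G : Graph n) where
  open Paths G

  record K23Frame : Set where
    field
      hub           : Fin 2 → V
      leg           : Fin 3 → List V
      distinct      : Uniq (hub zero ∷ leg zero ++ hub (suc zero) ∷ leg (suc zero) ++ leg (suc (suc zero)))
      leg-inhabited : ∀ ℓ → Inhabited (leg ℓ)
      leg-path      : ∀ ℓ → Path (leg ℓ)
      hub-leg       : ∀ h ℓ → NeighbourIn (hub h) (leg ℓ)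

  module _ (F : K23Frame) where
    open K23Frame F

    branchList : Fin 5 → List V
    branchList zero = [ hub zero ]
    branchList (suc zero) = [ hub (suc zero) ]
    branchList (suc (suc ℓ)) = leg ℓ

    private
      layout : List (List V)
      layout = [ hub zero ] ∷ leg zero ∷ [ hub (suc zero) ] ∷ leg (suc zero) ∷ leg (suc (suc zero)) ∷ []

      position : Fin 5 → Fin 5
      position zero = zero
      position (suc zero) = suc (suc zero)
      position (suc (suc zero)) = suc zero
      position (suc (suc (suc ℓ))) = suc (suc (suc ℓ))

      position-involutive : ∀ u → position (position u) ≡ u
      position-involutive zero = refl
      position-involutive (suc zero) = refl
      position-involutive (suc (suc zero)) = refl
      position-involutive (suc (suc (suc ℓ))) = refl

      branchList-layout : ∀ u → branchList u ≡ lookup layout (position u)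
      branchList-layout zero = refl
      branchList-layout (suc zero) = refl
      branchList-layout (suc (suc zero)) = refl
      branchList-layout (suc (suc (suc zero))) = refl
      branchList-layout (suc (suc (suc (suc zero)))) = refl

    branchList-disjoint : ∀ u v → u ≢ v → Disjoint (branchList u) (branchList v)
    branchList-disjoint u v u≢v rewrite branchList-layout u | branchList-layout v =
      concat-disjoint layout layout-distinct (position u) (position v) (u≢v ∘ position-injective)
      where
      layout-distinct : Uniq (concat layout)
      layout-distinct = subst (λ L → Uniq (hub zero ∷ leg zero ++ hub (suc zero) ∷ leg (suc zero) ++ L))
                          (sym (++-identityʳ (leg (suc (suc zero))))) distinct
      position-injective : position u ≡ position v → u ≡ v
      position-injective eq =
        trans (sym (position-involutive u)) (trans (cong position eq) (position-involutive v))

    branchList-inhabited : ∀ u → Inhabited (branchList u)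
    branchList-inhabited zero = hub zero , here refl
    branchList-inhabited (suc zero) = hub (suc zero) , here refl
    branchList-inhabited (suc (suc ℓ)) = leg-inhabited ℓ

    branchList-path : ∀ u → Path (branchList u)
    branchList-path zero = ⟨ hub zero ⟩
    branchList-path (suc zero) = ⟨ hub (suc zero) ⟩
    branchList-path (suc (suc ℓ)) = leg-path ℓ

    hub-edge : ∀ h ℓ → EdgeBetween [ hub h ] (leg ℓ)
    hub-edge h ℓ with hub-leg h ℓ
    ... | z , z∈ , e = hub h , z , here refl , z∈ , e

    branchList-edge : ∀ u v → Edge K23 u v → EdgeBetween (branchList u) (branchList v)
    branchList-edge zero (suc (suc ℓ)) _ = hub-edge zero ℓ
    branchList-edge (suc zero) (suc (suc ℓ)) _ = hub-edge (suc zero) ℓ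
    branchList-edge (suc (suc ℓ)) zero _ = edgeBetween-sym (hub-edge zero ℓ)
    branchList-edge (suc (suc ℓ)) (suc zero) _ = edgeBetween-sym (hub-edge (suc zero) ℓ)
    branchList-edge zero zero ()
    branchList-edge zero (suc zero) ()
    branchList-edge (suc zero) zero ()
    branchList-edge (suc zero) (suc zero) ()
    branchList-edge (suc (suc _)) (suc (suc _)) ()

    frame⇒K23 : HasMinor K23 G
    frame⇒K23 = record
      { branch    = λ u → ⟦ branchList u ⟧
      ; nonempty  = λ u → let (z , z∈) = branchList-inhabited u in z , ∈⟦⟧⁺ (branchList u) z∈
      ; connected = λ u → path-connected (branchList u) (branchList-path u) (∈⟦⟧⁺ (branchList u)) (λ v → ∈⟦⟧⁻ (branchList u))
      ; disjoint  = λ u v z u≢v z∈u z∈v →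
                      branchList-disjoint u v u≢v (∈⟦⟧⁻ (branchList u) z∈u) (∈⟦⟧⁻ (branchList v) z∈v)
      ; edges     = λ u v e → let (a , b , a∈ , b∈ , eab) = branchList-edge u v e in
                      a , b , ∈⟦⟧⁺ (branchList u) a∈ , ∈⟦⟧⁺ (branchList v) b∈ , eab
      }

  cycle-ear⇒K23 : ∀ x A y B I → Inhabited A → Inhabited B → Inhabited I →
                  Cycle (x ∷ A ++ y ∷ B) → Uniq (x ∷ A ++ y ∷ B) →
                  Path (x ∷ I ++ [ y ]) → Uniq I → Disjoint I (x ∷ A ++ y ∷ B) → HasMinor K23 G
  cycle-ear⇒K23 x A y B I A≠∅ B≠∅ I≠∅ cycle uniq ear uniqI disj = frame⇒K23 record
    { hub           = hub
    ; leg           = leg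
    ; distinct      = subst Uniq (cong (x ∷_) (++-assoc A (y ∷ B) I))
                        (uniq-++⁺ (x ∷ A ++ y ∷ B) uniq uniqI (λ m m′ → disj m′ m))
    ; leg-inhabited = leg-inhabited
    ; leg-path      = leg-path
    ; hub-leg       = hub-leg
    }
    where
    x-A-y-B-x : Path (x ∷ A ++ y ∷ (B ++ [ x ]))
    x-A-y-B-x = subst Path (cong (x ∷_) (++-assoc A (y ∷ B) [ x ])) cycle
    y-B-x : Path (y ∷ B ++ [ x ])
    y-B-x = proj₂ (path-split (x ∷ A) x-A-y-B-x)

    hub : Fin 2 → V
    hub zero = x
    hub (suc zero) = y
    leg : Fin 3 → List V
    leg zero = A
    leg (suc zero) = B
    leg (suc (suc zero)) = I

    leg-inhabited : ∀ ℓ → Inhabited (leg ℓ)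
    leg-inhabited zero = A≠∅
    leg-inhabited (suc zero) = B≠∅
    leg-inhabited (suc (suc zero)) = I≠∅
    leg-path : ∀ ℓ → Path (leg ℓ)
    leg-path zero = path-prefix A (path-tail x-A-y-B-x)
    leg-path (suc zero) = path-prefix B (path-tail y-B-x)
    leg-path (suc (suc zero)) = path-prefix I (path-tail ear)
    hub-leg : ∀ h ℓ → NeighbourIn (hub h) (leg ℓ)
    hub-leg zero zero = path-neighbourʳ x A x-A-y-B-x A≠∅
    hub-leg (suc zero) zero = path-neighbourˡ A (path-tail x-A-y-B-x) A≠∅
    hub-leg zero (suc zero) = path-neighbourˡ B (path-tail y-B-x) B≠∅
    hub-leg (suc zero) (suc zero) = path-neighbourʳ y B y-B-x B≠∅
    hub-leg zero (suc (suc zero)) = path-neighbourʳ x I ear I≠∅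
    hub-leg (suc zero) (suc (suc zero)) = path-neighbourˡ I (path-tail ear) I≠∅

  crossing-chords⇒K23 : ∀ p W q R r T s U → Inhabited W →
                        Cycle (marked4 p W q R r T s U) → Uniq (marked4 p W q R r T s U) →
                        E p r → E q s → HasMinor K23 G
  crossing-chords⇒K23 p W q R r T s U W≠∅ cycle uniq pr qs = frame⇒K23 record
    { hub           = hub
    ; leg           = leg
    ; distinct      = subst Uniq (cong (λ Z → p ∷ W ++ q ∷ Z) (sym (++-assoc R [ r ] (T ++ s ∷ U)))) uniq
    ; leg-inhabited = leg-inhabited
    ; leg-path      = leg-path
    ; hub-leg       = hub-leg
    }
    where
    closed : Path (marked4 p W q R r T s (U ++ [ p ]))
    closed = subst Path (marked4-++ p W q R r T s U [ p ]) cycle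
    q-to-p : Path (q ∷ R ++ r ∷ T ++ s ∷ (U ++ [ p ]))
    q-to-p = path-suffix (p ∷ W) closed
    q-R-r : Path (q ∷ R ++ [ r ])
    q-R-r = proj₁ (path-split (q ∷ R) q-to-p)
    R-r : Path (R ++ [ r ])
    R-r = proj₁ (path-split R (path-tail q-to-p))
    T-s-U-p : Path ((T ++ s ∷ U) ++ [ p ])
    T-s-U-p = subst Path (sym (++-assoc T (s ∷ U) [ p ]))
                (path-tail (proj₂ (path-split R (path-tail q-to-p))))
    r∈ : r ∈ₗ R ++ [ r ]
    r∈ = ∈-++⁺ʳ R (here refl)
    s∈ : s ∈ₗ T ++ s ∷ U
    s∈ = ∈-++⁺ʳ T (here refl)

    hub : Fin 2 → V
    hub zero = p
    hub (suc zero) = q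
    leg : Fin 3 → List V
    leg zero = W
    leg (suc zero) = R ++ [ r ]
    leg (suc (suc zero)) = T ++ s ∷ U

    leg-inhabited : ∀ ℓ → Inhabited (leg ℓ)
    leg-inhabited zero = W≠∅
    leg-inhabited (suc zero) = r , r∈
    leg-inhabited (suc (suc zero)) = s , s∈
    leg-path : ∀ ℓ → Path (leg ℓ)
    leg-path zero = path-prefix W (path-tail closed)
    leg-path (suc zero) = R-r
    leg-path (suc (suc zero)) = path-prefix (T ++ s ∷ U) T-s-U-p
    hub-leg : ∀ h ℓ → NeighbourIn (hub h) (leg ℓ)
    hub-leg zero zero = path-neighbourʳ p W closed W≠∅
    hub-leg (suc zero) zero = path-neighbourˡ W (path-tail closed) W≠∅
    hub-leg zero (suc zero) = r , r∈ , pr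
    hub-leg (suc zero) (suc zero) =
      path-neighbourʳ q (R ++ [ r ]) (subst (λ L → Path (q ∷ L)) (sym (++-identityʳ (R ++ [ r ]))) q-R-r) (r , r∈)
    hub-leg zero (suc (suc zero)) = path-neighbourˡ (T ++ s ∷ U) T-s-U-p (s , s∈)
    hub-leg (suc zero) (suc (suc zero)) = s , s∈ , qs

  private
    marked4-rotate : ∀ p Q q R r T s U → Cycle (marked4 p Q q R r T s U) → Uniq (marked4 p Q q R r T s U) →
                     Cycle (marked4 q R r T s U p Q) × Uniq (marked4 q R r T s U p Q)
    marked4-rotate p Q q R r T s U cycle uniq =
      subst Cycle rotated (cycle-rotate (p ∷ Q) (q ∷ R ++ r ∷ T ++ s ∷ U) cycle) ,
      subst Uniq rotated (uniq-++-comm (p ∷ Q) uniq)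
      where
      rotated : (q ∷ R ++ r ∷ T ++ s ∷ U) ++ p ∷ Q ≡ marked4 q R r T s U p Q
      rotated rewrite ++-assoc R (r ∷ T ++ s ∷ U) (p ∷ Q) | ++-assoc T (s ∷ U) (p ∷ Q) = refl

    marked4-crossing⇒K23 : ∀ p Q q R r T s U → Cycle (marked4 p Q q R r T s U) → Uniq (marked4 p Q q R r T s U) →
                           5 ≤ length (marked4 p Q q R r T s U) → E p r → E q s → HasMinor K23 G
    marked4-crossing⇒K23 p (x ∷ Q) q R r T s U c u _ pr qs =
      crossing-chords⇒K23 p (x ∷ Q) q R r T s U (x , here refl) c u pr qs
    marked4-crossing⇒K23 p [] q (x ∷ R) r T s U c u _ pr qs =
      let (c₁ , u₁) = marked4-rotate p [] q (x ∷ R) r T s U c u in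
      crossing-chords⇒K23 q (x ∷ R) r T s U p [] (x , here refl) c₁ u₁ qs (edge-sym pr)
    marked4-crossing⇒K23 p [] q [] r (x ∷ T) s U c u _ pr qs =
      let (c₁ , u₁) = marked4-rotate p [] q [] r (x ∷ T) s U c u in
      let (c₂ , u₂) = marked4-rotate q [] r (x ∷ T) s U p [] c₁ u₁ in
      crossing-chords⇒K23 r (x ∷ T) s U p [] q [] (x , here refl) c₂ u₂ (edge-sym pr) (edge-sym qs)
    marked4-crossing⇒K23 p [] q [] r [] s (x ∷ U) c u _ pr qs =
      let (c₁ , u₁) = marked4-rotate p [] q [] r [] s (x ∷ U) c u in
      let (c₂ , u₂) = marked4-rotate q [] r [] s (x ∷ U) p [] c₁ u₁ in
      let (c₃ , u₃) = marked4-rotate r [] s (x ∷ U) p [] q [] c₂ u₂ in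
      crossing-chords⇒K23 s (x ∷ U) p [] q [] r [] (x , here refl) c₃ u₃ (edge-sym qs) pr
    marked4-crossing⇒K23 p [] q [] r [] s [] c u (s≤s (s≤s (s≤s (s≤s ())))) pr qs

  cycle-crossing⇒K23 : ∀ L → Cycle L → Uniq L → 5 ≤ length L → ∀ (i a j b : Fin (length L)) →
                       toℕ i < toℕ a → toℕ a < toℕ j → toℕ j < toℕ b →
                       E (lookup L i) (lookup L j) → E (lookup L a) (lookup L b) → HasMinor K23 G
  cycle-crossing⇒K23 L cycle uniq 5≤ i a j b i<a a<j j<b ij ab with lookup-split₄ L i a j b i<a a<j j<b
  ... | P , Q , R , T , U , L≡ =
    marked4-crossing⇒K23 (lookup L i) Q (lookup L a) R (lookup L j) T (lookup L b) (U ++ P)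
      (subst Cycle rotated (cycle-rotate P M (subst Cycle L≡ cycle)))
      (subst Uniq rotated (uniq-++-comm P (subst Uniq L≡ uniq)))
      (subst (5 ≤_) (trans (cong length L≡) (trans (length-++-comm P M) (cong length rotated))) 5≤) ij ab
    where
    M = marked4 (lookup L i) Q (lookup L a) R (lookup L j) T (lookup L b) U
    rotated : M ++ P ≡ marked4 (lookup L i) Q (lookup L a) R (lookup L j) T (lookup L b) (U ++ P)
    rotated = marked4-++ (lookup L i) Q (lookup L a) R (lookup L j) T (lookup L b) U P

module Ears {n : ℕ} (G : Graph n) where
  open Paths G
  open DecMembership (_≟ᶠ_ {n}) using () renaming (_∈?_ to _∈ₗ?_)

  infixr 5 _▸_
  data Walk : V → V → Set where
    stop : ∀ v → Walk v v
    _▸_  : ∀ {u w v} → E u w → Walk w v → Walk u v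

  vertices : ∀ {u v} → Walk u v → List V
  vertices (stop v) = [ v ]
  vertices (_▸_ {u} e p) = u ∷ vertices p

  front : ∀ {u v} → Walk u v → List V
  front (stop v) = []
  front (_▸_ {u} e p) = u ∷ front p

  _++ʷ_ : ∀ {u v w} → Walk u v → Walk v w → Walk u w
  stop _ ++ʷ q = q
  (e ▸ p) ++ʷ q = e ▸ (p ++ʷ q)

  _⊆ₗ_ : List V → List V → Set
  xs ⊆ₗ ys = ∀ {z} → z ∈ₗ xs → z ∈ₗ ys

  Avoids : List V → List V → Set
  Avoids C xs = ∀ {z} → z ∈ₗ xs → z ∉ₗ C

  vertices≡front∷ʳ : ∀ {u v} (p : Walk u v) → vertices p ≡ front p ++ [ v ]
  vertices≡front∷ʳ (stop v) = refl
  vertices≡front∷ʳ (_▸_ {u} e p) = cong (u ∷_) (vertices≡front∷ʳ p)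

  front⊆vertices : ∀ {u v} (p : Walk u v) → front p ⊆ₗ vertices p
  front⊆vertices p m = subst (_ ∈ₗ_) (sym (vertices≡front∷ʳ p)) (∈-++⁺ˡ m)

  head∈vertices : ∀ {u v} (p : Walk u v) → u ∈ₗ vertices p
  head∈vertices (stop _) = here refl
  head∈vertices (_ ▸ _) = here refl

  last∈vertices : ∀ {u v} (p : Walk u v) → v ∈ₗ vertices p
  last∈vertices (stop _) = here refl
  last∈vertices (_ ▸ p) = there (last∈vertices p)

  front-++ʷ : ∀ {u v w} (p : Walk u v) (q : Walk v w) → front (p ++ʷ q) ≡ front p ++ front q
  front-++ʷ (stop _) q = refl
  front-++ʷ (_▸_ {u} e p) q = cong (u ∷_) (front-++ʷ p q)

  vertices-++ʷ : ∀ {u v w} (p : Walk u v) (q : Walk v w) → vertices (p ++ʷ q) ≡ front p ++ vertices q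
  vertices-++ʷ (stop _) q = refl
  vertices-++ʷ (_▸_ {u} e p) q = cong (u ∷_) (vertices-++ʷ p q)

  walk-path : ∀ {u v} (p : Walk u v) → Path (vertices p)
  walk-path (stop v) = ⟨ v ⟩
  walk-path (e ▸ stop v) = e ◅ ⟨ v ⟩
  walk-path (e ▸ e′ ▸ p) = e ◅ walk-path (e′ ▸ p)

  fromWalkIn : ∀ {S u v} → WalkIn G S u v → Σ (Walk u v) λ p → vertices p ⊆ₛ S
  fromWalkIn (here u∈) = stop _ , λ { (here refl) → u∈ }
  fromWalkIn (step u∈ e p) with fromWalkIn p
  ... | q , q⊆ = e ▸ q , λ { (here refl) → u∈ ; (there m) → q⊆ m }

  LastExit : List V → ∀ {a b} → Walk a b → Set
  LastExit C {b = b} p = Σ V λ x → x ∈ₗ C × Σ V λ w → E x w ×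
                         Σ (Walk w b) λ r → Avoids C (vertices r) × vertices r ⊆ₗ vertices p

  last-exit : ∀ C {a b} (p : Walk a b) → b ∉ₗ C → Avoids C (vertices p) ⊎ LastExit C p
  last-exit C (stop b) b∉ = inj₁ λ { (here refl) → b∉ }
  last-exit C (_▸_ {a} {w} e r) b∉ with last-exit C r b∉
  ... | inj₂ (x , x∈ , w′ , e′ , r′ , avoids , r′⊆) = inj₂ (x , x∈ , w′ , e′ , r′ , avoids , there ∘ r′⊆)
  ... | inj₁ avoids with a ∈ₗ? C
  ...   | yes a∈ = inj₂ (a , a∈ , w , e , r , avoids , there)
  ...   | no a∉ = inj₁ λ { (here refl) → a∉ ; (there m) → avoids m }

  FirstEntry : List V → ∀ {a b} → Walk a b → Set
  FirstEntry C {a} p = Σ V λ y → y ∈ₗ C × Σ (Walk a y) λ q → Avoids C (front q) × vertices q ⊆ₗ vertices p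

  first-entry : ∀ C {a b} (p : Walk a b) → b ∈ₗ C → FirstEntry C p
  first-entry C (stop b) b∈ = b , b∈ , stop b , (λ ()) , (λ m → m)
  first-entry C (_▸_ {a} e r) b∈ with a ∈ₗ? C | first-entry C r b∈
  ... | yes a∈ | _ = a , a∈ , stop a , (λ ()) , λ { (here refl) → here refl }
  ... | no a∉ | y , y∈ , q , avoids , q⊆ =
    y , y∈ , e ▸ q , (λ { (here refl) → a∉ ; (there m) → avoids m }) , λ { (here refl) → here refl ; (there m) → there (q⊆ m) }

  private
    suffix-at : ∀ {a c b} (q : Walk c b) → a ∈ₗ vertices q → Σ (Walk a b) λ q′ → Σ (List V) λ pre → vertices q ≡ pre ++ vertices q′
    suffix-at (stop b) (here refl) = stop b , [] , refl
    suffix-at (e ▸ q) (here refl) = e ▸ q , [] , refl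
    suffix-at (_▸_ {c} e q) (there m) with suffix-at q m
    ... | q′ , pre , eq = q′ , c ∷ pre , cong (c ∷_) eq

  Shortcut : ∀ {a b} → Walk a b → Set
  Shortcut {a} {b} p = Σ (Walk a b) λ q → Uniq (vertices q) × vertices q ⊆ₗ vertices p

  shortcut : ∀ {a b} (p : Walk a b) → Shortcut p
  shortcut (stop b) = stop b , (λ ()) ∷ [] , (λ m → m)
  shortcut (_▸_ {a} e r) with shortcut r
  ... | q , uniq , q⊆ with a ∈ₗ? vertices q
  ...   | no a∉ = e ▸ q , a∉ ∷ uniq , λ { (here refl) → here refl ; (there m) → there (q⊆ m) }
  ...   | yes a∈ with suffix-at q a∈
  ...     | q′ , pre , eq = q′ , proj₁ (proj₂ (uniq-++⁻ pre (subst Uniq eq uniq))) ,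
                            λ m → there (q⊆ (subst (_ ∈ₗ_) (sym eq) (∈-++⁺ʳ pre m)))

  record Ear (S : Subset n) (C : List V) : Set where
    field
      x y      : V
      x∈C      : x ∈ₗ C
      y∈C      : y ∈ₗ C
      x≢y      : x ≢ y
      interior      : List V
      interior≠∅    : Inhabited interior
      interior-off  : Disjoint interior C
      interior-uniq : Uniq interior
      interior⊆S    : interior ⊆ₛ S
      path          : Path (x ∷ interior ++ [ y ])

  module _ {S : Subset n} {C : List V} where

    walk⇒ear : ∀ {x w y} → x ∈ₗ C → y ∈ₗ C → x ≢ y → E x w → w ∉ₗ C → (p : Walk w y) →
               Avoids C (front p) → vertices p ⊆ₛ S → Ear S C
    walk⇒ear {x} {w} {y} x∈ y∈ x≢y xw w∉ p avoids p⊆S with shortcut p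
    ... | q , uniq , q⊆p = record
      { x = x ; y = y ; x∈C = x∈ ; y∈C = y∈ ; x≢y = x≢y
      ; interior      = front q
      ; interior≠∅    = front-inhabited q
      ; interior-off  = off
      ; interior-uniq = proj₁ split
      ; interior⊆S    = p⊆S ∘ q⊆p ∘ front⊆vertices q
      ; path          = subst Path (cong (x ∷_) (vertices≡front∷ʳ q)) (walk-path (xw ▸ q))
      }
      where
      split : Uniq (front q) × Uniq [ y ] × Disjoint (front q) [ y ]
      split = uniq-++⁻ (front q) (subst Uniq (vertices≡front∷ʳ q) uniq)
      front-inhabited : (q : Walk w y) → Inhabited (front q)
      front-inhabited (stop _) = ⊥-elim (w∉ y∈)
      front-inhabited (_ ▸ _) = w , here refl
      off : Disjoint (front q) C
      off {z} z∈q z∈C with ∈-++⁻ (front p) (subst (z ∈ₗ_) (vertices≡front∷ʳ p) (q⊆p (front⊆vertices q z∈q)))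
      ... | inj₁ z∈p = avoids z∈p z∈C
      ... | inj₂ (here refl) = proj₂ (proj₂ split) z∈q (here refl)

    -- Leave C for the last time on a walk to v, then return from v to C inside S - x,
    -- where x is the exit vertex; the return point y is thus different from x.
    ear-exists : ConnectedIn G S → (∀ x → x ∈ S → ConnectedIn G (S - x)) → C ⊆ₛ S →
                 (∀ x → x ∈ₗ C → Σ V λ y → y ∈ₗ C × y ≢ x) →
                 ∀ {c v} → c ∈ₗ C → v ∈ S → v ∉ₗ C → Ear S C
    ear-exists connected connected-minus C⊆S other {c} {v} c∈ v∈S v∉ with fromWalkIn (connected c v (C⊆S c∈) v∈S)
    ... | P , P⊆S with last-exit C P v∉
    ... | inj₁ avoids = ⊥-elim (avoids (head∈vertices P) c∈)
    ... | inj₂ (x , x∈ , w , xw , r , r-avoids , r⊆P) with other x x∈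
    ... | y₀ , y₀∈ , y₀≢x with fromWalkIn (connected-minus x (C⊆S x∈) v y₀
                                 (x∈p∧x≢y⇒x∈p-y v∈S λ { refl → v∉ x∈ }) (x∈p∧x≢y⇒x∈p-y (C⊆S y₀∈) y₀≢x))
    ... | Q , Q⊆S-x with first-entry C Q y₀∈
    ... | y , y∈ , q , q-avoids , q⊆Q =
      walk⇒ear x∈ y∈ (λ x≡y → proj₂ (x∈p-y⇒x∈p×x≢y (Q⊆S-x (q⊆Q (last∈vertices q)))) (sym x≡y))
        xw (r-avoids (head∈vertices r)) (r ++ʷ q) front-avoids r++q⊆S
      where
      front-avoids : Avoids C (front (r ++ʷ q))
      front-avoids m with ∈-++⁻ (front r) (subst (_ ∈ₗ_) (front-++ʷ r q) m)
      ... | inj₁ m′ = r-avoids (front⊆vertices r m′)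
      ... | inj₂ m′ = q-avoids m′
      r++q⊆S : vertices (r ++ʷ q) ⊆ₛ S
      r++q⊆S m with ∈-++⁻ (front r) (subst (_ ∈ₗ_) (vertices-++ʷ r q) m)
      ... | inj₁ m′ = P⊆S (r⊆P (front⊆vertices r m′))
      ... | inj₂ m′ = proj₁ (x∈p-y⇒x∈p×x≢y (Q⊆S-x (q⊆Q m′)))

module CycleGrowth {n : ℕ} (G : Graph n) where
  open Paths G
  open K23Frames G
  open Ears G

  LongerCycle : Subset n → List V → Set
  LongerCycle S C = Σ (List V) λ C′ → Cycle C′ × Uniq C′ × C′ ⊆ₛ S × length C < length C′

  private
    length-< : ∀ (I ys : List V) → Inhabited I → length ys < length (I ++ ys)
    length-< (_ ∷ I) ys _ = s≤s (length-++-≤ʳ ys {I})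

    ⊆ₛ-insert : ∀ {S} x I ys → (x ∷ ys) ⊆ₛ S → I ⊆ₛ S → (x ∷ I ++ ys) ⊆ₛ S
    ⊆ₛ-insert x I ys x∷ys⊆ I⊆ (here refl) = x∷ys⊆ (here refl)
    ⊆ₛ-insert x I ys x∷ys⊆ I⊆ (there m) = [ I⊆ , x∷ys⊆ ∘ there ]′ (∈-++⁻ I m)

  splice : ∀ x y B I → Cycle (x ∷ y ∷ B) → Uniq (x ∷ y ∷ B) → Path (x ∷ I ++ [ y ]) → Uniq I →
           Disjoint I (x ∷ y ∷ B) → Cycle (x ∷ I ++ y ∷ B) × Uniq (x ∷ I ++ y ∷ B)
  splice x y B I cycle (x∉ ∷ uniq) ear uniqI disj =
    subst Path (cong (x ∷_) (sym (++-assoc I (y ∷ B) [ x ]))) (path-join (x ∷ I) ear (path-tail cycle)) ,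
    x∉I++y∷B ∷ uniq-++⁺ I uniqI uniq (λ m m′ → disj m (there m′))
    where
    x∉I++y∷B : x ∉ₗ I ++ y ∷ B
    x∉I++y∷B m = [ (λ m′ → disj m′ (here refl)) , x∉ ]′ (∈-++⁻ I m)

  grow-at : ∀ {S} x A y B I → ¬ HasMinor K23 G →
            Cycle (x ∷ A ++ y ∷ B) → Uniq (x ∷ A ++ y ∷ B) → (x ∷ A ++ y ∷ B) ⊆ₛ S →
            Path (x ∷ I ++ [ y ]) → Uniq I → Inhabited I → Disjoint I (x ∷ A ++ y ∷ B) → I ⊆ₛ S →
            LongerCycle S (x ∷ A ++ y ∷ B)
  grow-at x [] y B I _ cycle uniq C⊆S ear uniqI I≠∅ disj I⊆S =
    let (cycle′ , uniq′) = splice x y B I cycle uniq ear uniqI disj in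
    x ∷ I ++ y ∷ B , cycle′ , uniq′ , ⊆ₛ-insert x I (y ∷ B) C⊆S I⊆S , s≤s (length-< I (y ∷ B) I≠∅)
  grow-at x (a ∷ A) y [] I _ cycle uniq C⊆S ear uniqI (i , i∈) disj I⊆S =
    let (cycle′ , uniq′) = splice y x (a ∷ A) (reverse I) rotated-cycle rotated-uniq reversed-ear
                             (uniq-reverse I uniqI) (λ m m′ → disj (reverse⁻ m) (∈-++-comm [ y ] m′)) in
    y ∷ reverse I ++ x ∷ a ∷ A , cycle′ , uniq′ ,
    ⊆ₛ-insert y (reverse I) (x ∷ a ∷ A) (C⊆S ∘ ∈-++-comm [ y ]) (I⊆S ∘ reverse⁻) ,
    subst (_< length (y ∷ reverse I ++ x ∷ a ∷ A)) (length-++-comm [ y ] (x ∷ a ∷ A))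
      (s≤s (length-< (reverse I) (x ∷ a ∷ A) (i , reverse⁺ i∈)))
    where
    rotated-cycle : Cycle (y ∷ x ∷ a ∷ A)
    rotated-cycle = cycle-rotate (x ∷ a ∷ A) [ y ] cycle
    rotated-uniq : Uniq (y ∷ x ∷ a ∷ A)
    rotated-uniq = uniq-++-comm (x ∷ a ∷ A) uniq
    reversed-ear : Path (y ∷ reverse I ++ [ x ])
    reversed-ear = subst Path (trans (unfold-reverse x (I ++ [ y ])) (cong (_++ [ x ]) (reverse-++ I [ y ])))
                     (path-reverse (x ∷ I ++ [ y ]) ear)
  grow-at x (a ∷ A) y (b ∷ B) I no-minor cycle uniq _ ear uniqI I≠∅ disj _ =
    ⊥-elim (no-minor (cycle-ear⇒K23 x (a ∷ A) y (b ∷ B) I (a , here refl) (b , here refl) I≠∅ cycle uniq ear uniqI disj))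

  private
    grow-from : ∀ {S} x D → ¬ HasMinor K23 G → Cycle (x ∷ D) → Uniq (x ∷ D) → (x ∷ D) ⊆ₛ S →
                ∀ {y} → y ∈ₗ D → ∀ I → Path (x ∷ I ++ [ y ]) → Uniq I → Inhabited I → Disjoint I (x ∷ D) → I ⊆ₛ S →
                LongerCycle S (x ∷ D)
    grow-from x D no-minor cycle uniq D⊆S y∈ I ear uniqI I≠∅ disj I⊆S with ∈-∃++ y∈
    ... | A , B , refl = grow-at x A _ B I no-minor cycle uniq D⊆S ear uniqI I≠∅ disj I⊆S

  longerCycle-resp-length : ∀ {S C D} → length C ≡ length D → LongerCycle S D → LongerCycle S C
  longerCycle-resp-length C≡D (C′ , cycle , uniq , C′⊆S , longer) =
    C′ , cycle , uniq , C′⊆S , subst (_< length C′) (sym C≡D) longer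

  grow : ∀ {S} C → ¬ HasMinor K23 G → Cycle C → Uniq C → C ⊆ₛ S → Ear S C → LongerCycle S C
  grow {S} C no-minor cycle uniq C⊆S ear with ∈-∃++ (Ear.x∈C ear)
  ... | C₁ , C₂ , C≡ =
    longerCycle-resp-length {C = C} {D = x ∷ C₂ ++ C₁} (trans (cong length C≡) (length-++-comm C₁ (x ∷ C₂)))
      (grow-from x (C₂ ++ C₁) no-minor
         (cycle-rotate C₁ (x ∷ C₂) (subst Cycle C≡ cycle)) (uniq-++-comm C₁ (subst Uniq C≡ uniq))
         (C⊆S ∘ back) y∈rotated interior path interior-uniq interior≠∅
         (λ m m′ → interior-off m (back m′)) interior⊆S)
    where
    open Ear ear
    back : ∀ {z} → z ∈ₗ x ∷ C₂ ++ C₁ → z ∈ₗ C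
    back m = subst (_ ∈ₗ_) (sym C≡) (∈-++-comm (x ∷ C₂) m)
    y∈rotated : y ∈ₗ C₂ ++ C₁
    y∈rotated with ∈-++-comm C₁ (subst (_ ∈ₗ_) C≡ y∈C)
    ... | here y≡x = ⊥-elim (x≢y (sym y≡x))
    ... | there m = m

module Drawings {n : ℕ} (G : Graph n) where
  open Paths G

  Covers : Subset n → List V → Set
  Covers S L = Uniq L × L ⊆ₛ S × (∀ v → v ∈ S → v ∈ₗ L)

  covers⇒enumerates : ∀ {S} L → Covers S L → Enumerates G S (length L) (lookup L)
  covers⇒enumerates L (uniq , L⊆S , cover) =
    (λ {i} {j} → lookup-injective L uniq i j) ,
    (λ v v∈ → index (cover v v∈) , sym (lookup-index (cover v v∈))) ,
    (λ i → L⊆S (∈-lookup i))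

  path-lookup-edge : ∀ xs → Path xs → ∀ (i j : Fin (length xs)) → toℕ j ≡ suc (toℕ i) → E (lookup xs i) (lookup xs j)
  path-lookup-edge (x ∷ y ∷ ys) (e ◅ p) zero (suc zero) _ = e
  path-lookup-edge (x ∷ y ∷ ys) (e ◅ p) (suc i) (suc j) eq = path-lookup-edge (y ∷ ys) p i j (suc-injective eq)

  cycle-closing-edge : ∀ z zs → Cycle (z ∷ zs) → E (lookup (z ∷ zs) (fromℕ (length zs))) z
  cycle-closing-edge z zs = go z zs
    where
    go : ∀ y ys → Path (y ∷ ys ++ [ z ]) → E (lookup (y ∷ ys) (fromℕ (length ys))) z
    go y [] (e ◅ _) = e
    go y (y′ ∷ ys) (_ ◅ p) = go y′ ys p

  covering-cycle⇒hamCycle : ∀ {S} L → Cycle L → Covers S L → 3 ≤ length L → HamCycle G S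
  covering-cycle⇒hamCycle (a ∷ b ∷ c ∷ rest) cycle covers _ =
    length rest , lookup (a ∷ b ∷ c ∷ rest) , covers⇒enumerates _ covers ,
    path-lookup-edge (a ∷ b ∷ c ∷ rest) (path-prefix (a ∷ b ∷ c ∷ rest) cycle) ,
    cycle-closing-edge a (b ∷ c ∷ rest) cycle
  covering-cycle⇒hamCycle (a ∷ []) _ _ (s≤s ())
  covering-cycle⇒hamCycle (a ∷ b ∷ []) _ _ (s≤s (s≤s ()))

  private
    increasing-below-4 : ∀ {i a j b : ℕ} → i < a → a < j → j < b → b < 4 → i ≡ 0 × a ≡ 1 × j ≡ 2 × b ≡ 3
    increasing-below-4 (s≤s z≤n) (s≤s (s≤s z≤n)) (s≤s (s≤s (s≤s z≤n))) (s≤s (s≤s (s≤s (s≤s z≤n)))) = refl , refl , refl , refl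

  interleaved-unique : ∀ {k} {i j a b a′ b′ : Fin k} → k ≤ 4 →
                       Interleaved G i j a b → Interleaved G i j a′ b′ → a ≡ a′ × b ≡ b′
  interleaved-unique {k} {i} {j} {a} {b} {a′} {b′} k≤4 = go
    where
    <4 : ∀ (x : Fin k) → toℕ x < 4
    <4 x = ≤-trans (toℕ<n x) k≤4
    toℕ-equal : ∀ {x y : Fin k} {m} → toℕ x ≡ m → toℕ y ≡ m → x ≡ y
    toℕ-equal x≡m y≡m = toℕ-injective (trans x≡m (sym y≡m))
    go : Interleaved G i j a b → Interleaved G i j a′ b′ → a ≡ a′ × b ≡ b′
    go (inj₁ (i<a , a<j , j<b)) (inj₁ (i<a′ , a′<j , j<b′))
      with increasing-below-4 i<a a<j j<b (<4 b) | increasing-below-4 i<a′ a′<j j<b′ (<4 b′)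
    ... | _ , a≡ , _ , b≡ | _ , a′≡ , _ , b′≡ = toℕ-equal a≡ a′≡ , toℕ-equal b≡ b′≡
    go (inj₂ (a<i , i<b , b<j)) (inj₂ (a′<i , i<b′ , b′<j))
      with increasing-below-4 a<i i<b b<j (<4 j) | increasing-below-4 a′<i i<b′ b′<j (<4 j)
    ... | a≡ , _ , b≡ , _ | a′≡ , _ , b′≡ , _ = toℕ-equal a≡ a′≡ , toℕ-equal b≡ b′≡
    go (inj₁ (i<a , a<j , j<b)) (inj₂ (a′<i , i<b′ , b′<j))
      with increasing-below-4 i<a a<j j<b (<4 b) | increasing-below-4 a′<i i<b′ b′<j (<4 j)
    ... | i≡0 , _ | _ , i≡1 , _ with trans (sym i≡0) i≡1
    ...   | ()
    go (inj₂ (a<i , i<b , b<j)) (inj₁ (i<a′ , a′<j , j<b′))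
      with increasing-below-4 a<i i<b b<j (<4 j) | increasing-below-4 i<a′ a′<j j<b′ (<4 b′)
    ... | _ , i≡1 , _ | i≡0 , _ with trans (sym i≡0) i≡1
    ...   | ()

  UniqueCrossings : List V → Set
  UniqueCrossings L = ∀ (i j a b a′ b′ : Fin (length L)) → i <ᶠ j → a <ᶠ b → a′ <ᶠ b′ →
                      E (lookup L i) (lookup L j) → E (lookup L a) (lookup L b) → E (lookup L a′) (lookup L b′) →
                      Interleaved G i j a b → Interleaved G i j a′ b′ → a ≡ a′ × b ≡ b′

  covers⇒pseudoOuterplanar : ∀ {S} L → Covers S L → UniqueCrossings L → PseudoOuterplanarIn G S
  covers⇒pseudoOuterplanar L covers unique = length L , lookup L , covers⇒enumerates L covers , unique

  short⇒uniqueCrossings : ∀ L → length L ≤ 4 → UniqueCrossings L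
  short⇒uniqueCrossings L ≤4 _ _ _ _ _ _ _ _ _ _ _ _ crosses crosses′ = interleaved-unique ≤4 crosses crosses′

  NoCrossing : List V → Set
  NoCrossing L = ∀ (i a j b : Fin (length L)) → i <ᶠ a → a <ᶠ j → j <ᶠ b →
                 E (lookup L i) (lookup L j) → E (lookup L a) (lookup L b) → ⊥

  noCrossing⇒uniqueCrossings : ∀ L → NoCrossing L → UniqueCrossings L
  noCrossing⇒uniqueCrossings L plane i j a b _ _ _ _ _ ij ab _ (inj₁ (i<a , a<j , j<b)) _ =
    ⊥-elim (plane i a j b i<a a<j j<b ij ab)
  noCrossing⇒uniqueCrossings L plane i j a b _ _ _ _ _ ij ab _ (inj₂ (a<i , i<b , b<j)) _ =
    ⊥-elim (plane a i b j a<i i<b b<j ab ij)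

  covering-cycle⇒biconnected : ∀ {S} L → Cycle L → Covers S L → Biconnected G S
  covering-cycle⇒biconnected {S} (c ∷ L) cycle covers@(uniq , L⊆S , cover) =
    (c , L⊆S (here refl)) ,
    path-connected (c ∷ L) (path-prefix (c ∷ L) cycle) L⊆S cover ,
    connected-minus
    where
    connected-minus : ∀ x → x ∈ S → ConnectedIn G (S - x)
    connected-minus x x∈S with ∈-∃++ (cover x x∈S)
    ... | L₁ , L₂ , L≡ =
      path-connected (L₂ ++ L₁) (path-prefix (L₂ ++ L₁) (path-tail rotated)) rest⊆S-x rest-covers
      where
      rotated : Cycle (x ∷ L₂ ++ L₁)
      rotated = cycle-rotate L₁ (x ∷ L₂) (subst Cycle L≡ cycle)
      x∉rest : x ∉ₗ L₂ ++ L₁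
      x∉rest with uniq-++-comm L₁ (subst Uniq L≡ uniq)
      ... | x∉ ∷ _ = x∉
      back : ∀ {z} → z ∈ₗ L₂ ++ L₁ → z ∈ₗ c ∷ L
      back m = subst (_ ∈ₗ_) (sym L≡) (∈-++-comm (x ∷ L₂) (there m))
      rest⊆S-x : (L₂ ++ L₁) ⊆ₛ (S - x)
      rest⊆S-x m = x∈p∧x≢y⇒x∈p-y (L⊆S (back m)) λ { refl → x∉rest m }
      rest-covers : ∀ v → v ∈ S - x → v ∈ₗ L₂ ++ L₁
      rest-covers v v∈ with x∈p-y⇒x∈p×x≢y v∈
      ... | v∈S , v≢x with ∈-++-comm L₁ (subst (_ ∈ₗ_) L≡ (cover v v∈S))
      ...   | here v≡x = ⊥-elim (v≢x v≡x)
      ...   | there m = m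

module K23FreeBlocks {n : ℕ} (G : Graph n) (no-minor : ¬ HasMinor K23 G) where
  open Paths G
  open K23Frames G
  open Ears G
  open CycleGrowth G
  open Drawings G
  open DecMembership (_≟ᶠ_ {n}) using () renaming (_∈?_ to _∈ₗ?_)

  module _ {S : Subset n} (connected : ConnectedIn G S) (connected-minus : ∀ x → x ∈ S → ConnectedIn G (S - x)) where

    CoveringCycle : Set
    CoveringCycle = Σ (List V) λ L → Cycle L × Covers S L × 2 ≤ length L

    uncovered? : ∀ C → (Σ V λ v → v ∈ S × v ∉ₗ C) ⊎ (∀ v → v ∈ S → v ∈ₗ C)
    uncovered? C with any? (λ v → (v ∈? S) ×-dec ¬? (v ∈ₗ? C))
    ... | yes (v , v∈S , v∉C) = inj₁ (v , v∈S , v∉C)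
    ... | no none = inj₂ covered
      where
      covered : ∀ v → v ∈ S → v ∈ₗ C
      covered v v∈S with v ∈ₗ? C
      ... | yes v∈C = v∈C
      ... | no v∉C = ⊥-elim (none (v , v∈S , v∉C))

    another : ∀ c₀ c₁ C → Uniq (c₀ ∷ c₁ ∷ C) → ∀ x → x ∈ₗ c₀ ∷ c₁ ∷ C → Σ V λ y → y ∈ₗ c₀ ∷ c₁ ∷ C × y ≢ x
    another c₀ c₁ C (c₀∉ ∷ _) x _ with x ≟ᶠ c₀
    ... | yes refl = c₁ , there (here refl) , λ c₁≡c₀ → c₀∉ (here (sym c₁≡c₀))
    ... | no x≢c₀ = c₀ , here refl , x≢c₀ ∘ sym

    extend-to-covering : ∀ fuel C → n < length C + fuel → Cycle C → Uniq C → C ⊆ₛ S → 2 ≤ length C → CoveringCycle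
    extend-to-covering fuel (c₀ ∷ c₁ ∷ C) bound cycle uniq C⊆S 2≤ with uncovered? (c₀ ∷ c₁ ∷ C)
    ... | inj₂ cover = _ , cycle , (uniq , C⊆S , cover) , 2≤
    ... | inj₁ (v , v∈S , v∉C) =
      continue fuel bound
        (grow _ no-minor cycle uniq C⊆S
          (ear-exists connected connected-minus C⊆S (another c₀ c₁ C uniq) (here refl) v∈S v∉C))
      where
      continue : ∀ fuel → n < length (c₀ ∷ c₁ ∷ C) + fuel → LongerCycle S (c₀ ∷ c₁ ∷ C) → CoveringCycle
      continue zero bound _ =
        ⊥-elim (<-irrefl refl (≤-trans bound (subst (_≤ n) (sym (+-identityʳ _)) (uniq-length≤ _ uniq))))
      continue (suc fuel) bound (C′ , cycle′ , uniq′ , C′⊆S , longer) =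
        extend-to-covering fuel C′
          (≤-trans bound (subst (_≤ length C′ + fuel) (sym (+-suc _ fuel)) (+-mono-≤ longer ≤-refl)))
          cycle′ uniq′ C′⊆S (≤-trans 2≤ (<⇒≤ longer))
    extend-to-covering _ (_ ∷ []) _ _ _ _ (s≤s ())

    singleton-or-covering-cycle : Nonempty S → (Σ V λ x → Covers S [ x ]) ⊎ CoveringCycle
    singleton-or-covering-cycle (x , x∈S) with uncovered? [ x ]
    ... | inj₂ cover = inj₁ (x , (λ ()) ∷ [] , (λ { (here refl) → x∈S }) , cover)
    ... | inj₁ (v , v∈S , v∉) = inj₂ (from-walk (connected x v x∈S v∈S))
      where
      from-walk : WalkIn G S x v → CoveringCycle
      from-walk (here _) = ⊥-elim (v∉ (here refl))
      from-walk (step {w = y} _ xy p) =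
        extend-to-covering n (x ∷ y ∷ []) (s≤s (m≤n⇒m≤1+n ≤-refl)) (xy ◅ edge-sym xy ◅ ⟨ x ⟩)
          ((λ { (here x≡y) → edge-irrefl xy x≡y }) ∷ (λ ()) ∷ [])
          (λ { (here refl) → x∈S ; (there (here refl)) → walkIn-head p })
          (s≤s (s≤s z≤n))

  biconnected⇒hamiltonian×pseudoOuterplanar : ∀ S → Biconnected G S → HamiltonianIn G S × PseudoOuterplanarIn G S
  biconnected⇒hamiltonian×pseudoOuterplanar S (nonempty , connected , connected-minus)
    with singleton-or-covering-cycle connected connected-minus nonempty
  ... | inj₁ (x , covers) =
    inj₁ (≤-trans (covered⇒∣S∣≤length [ x ] S (proj₂ (proj₂ covers))) (s≤s z≤n)) ,
    covers⇒pseudoOuterplanar [ x ] covers (short⇒uniqueCrossings [ x ] (s≤s z≤n))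
  ... | inj₂ (L , cycle , covers@(uniq , _ , cover) , _) =
    hamiltonian (length L ≤? 2) , covers⇒pseudoOuterplanar L covers (unique-crossings (length L ≤? 4))
    where
    hamiltonian : Dec (length L ≤ 2) → HamiltonianIn G S
    hamiltonian (yes ≤2) = inj₁ (≤-trans (covered⇒∣S∣≤length L S cover) ≤2)
    hamiltonian (no ≰2) = inj₂ (covering-cycle⇒hamCycle L cycle covers (≰⇒> ≰2))
    unique-crossings : Dec (length L ≤ 4) → UniqueCrossings L
    unique-crossings (yes ≤4) = short⇒uniqueCrossings L ≤4
    unique-crossings (no ≰4) = noCrossing⇒uniqueCrossings L λ i a j b i<a a<j j<b ij ab →
      no-minor (cycle-crossing⇒K23 L cycle uniq (≰⇒> ≰4) i a j b i<a a<j j<b ij ab)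

K23-free⇒InPH : (n : ℕ) (G : Graph n) → ¬ HasMinor K23 G → InPH G
K23-free⇒InPH n G no-minor =
  (λ S block → proj₁ (block-properties S (proj₁ block))) , (λ S block → proj₂ (block-properties S (proj₁ block)))
  where
  open K23FreeBlocks G no-minor renaming (biconnected⇒hamiltonian×pseudoOuterplanar to block-properties)

edges⊆⇒minor : ∀ {m} {H G : Graph m} → (∀ x y → Edge H x y → Edge G x y) → HasMinor H G
edges⊆⇒minor {G = G} H⊆G = record
  { branch    = ⁅_⁆
  ; nonempty  = λ v → v , x∈⁅x⁆ v
  ; connected = λ v a b a∈ b∈ → subst₂ (WalkIn G ⁅ v ⁆) (sym (x∈⁅y⁆⇒x≡y v a∈)) (sym (x∈⁅y⁆⇒x≡y v b∈)) (here (x∈⁅x⁆ v))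
  ; disjoint  = λ u v x u≢v x∈u x∈v → u≢v (trans (sym (x∈⁅y⁆⇒x≡y u x∈u)) (x∈⁅y⁆⇒x≡y v x∈v))
  ; edges     = λ u v e → u , v , x∈⁅x⁆ u , x∈⁅x⁆ v , H⊆G u v e
  }

module K23WithChord where

  pattern v₀ = zero
  pattern v₁ = suc zero
  pattern v₂ = suc (suc zero)
  pattern v₃ = suc (suc (suc zero))
  pattern v₄ = suc (suc (suc (suc zero)))

  chord : Fin 5 → Fin 5 → Bool
  chord v₃ v₄ = true
  chord v₄ v₃ = true
  chord _ _ = false

  adjacency : Fin 5 → Fin 5 → Bool
  adjacency x y = k23adj x y ∨ chord x y

  K23⁺ : Graph 5
  K23⁺ = record
    { adj     = adjacency
    ; adj-sym = toWitness {a? = all? λ x → all? λ y → adjacency x y Bool.≟ adjacency y x} _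
    ; adj-irr = toWitness {a? = all? λ x → adjacency x x Bool.≟ false} _
    }

  K23⁺-minor : HasMinor K23 K23⁺
  K23⁺-minor = edges⊆⇒minor λ x y e → cong (_∨ chord x y) e

  open Paths K23⁺
  open Drawings K23⁺

  order : List (Fin 5)
  order = v₀ ∷ v₂ ∷ v₁ ∷ v₃ ∷ v₄ ∷ []

  order-cycle : Cycle order
  order-cycle = refl ◅ refl ◅ refl ◅ refl ◅ refl ◅ ⟨ v₀ ⟩

  order-uniq : Uniq order
  order-uniq = (λ { (here ()) ; (there (here ())) ; (there (there (here ()))) ; (there (there (there (here ())))) })
             ∷ (λ { (here ()) ; (there (here ())) ; (there (there (here ()))) })
             ∷ (λ { (here ()) ; (there (here ())) })
             ∷ (λ { (here ()) })
             ∷ (λ ())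
             ∷ []

  ∈order : ∀ v → v ∈ₗ order
  ∈order v₀ = here refl
  ∈order v₂ = there (here refl)
  ∈order v₁ = there (there (here refl))
  ∈order v₃ = there (there (there (here refl)))
  ∈order v₄ = there (there (there (there (here refl))))

  order-covers : ∀ S → ⊤ ⊆ S → Covers S order
  order-covers S ⊤⊆S = order-uniq , (λ _ → ⊤⊆S ∈⊤) , (λ v _ → ∈order v)

  block⇒⊤⊆ : ∀ S → IsBlock K23⁺ S → ⊤ ⊆ S
  block⇒⊤⊆ S (_ , maximal) =
    maximal ⊤ (λ _ → ∈⊤) (covering-cycle⇒biconnected order order-cycle (order-covers ⊤ (λ m → m)))

  -- In the cyclic order 0,2,1,3,4 the only crossing pair of edges occupies positions {0,3} and {2,4},
  -- so every edge crossed by (i, j) is the edge at positions (crossing₁ i j , crossing₂ i j).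
  crossing₁ crossing₂ : Fin 5 → Fin 5 → Fin 5
  crossing₁ v₀ v₃ = v₂
  crossing₁ _ _ = v₀
  crossing₂ v₀ v₃ = v₄
  crossing₂ _ _ = v₃

  CrossedBy : Fin 5 → Fin 5 → Fin 5 → Fin 5 → Set
  CrossedBy i j a b = Interleaved K23⁺ i j a b → E (lookup order i) (lookup order j) →
                      E (lookup order a) (lookup order b) → a ≡ crossing₁ i j × b ≡ crossing₂ i j

  crossedBy : ∀ i j a b → CrossedBy i j a b
  crossedBy = toWitness {a? = all? λ i → all? λ j → all? λ a → all? λ b → crossedBy? i j a b} _
    where
    edge? : ∀ x y → Dec (E x y)
    edge? x y = adjacency x y Bool.≟ true
    interleaved? : ∀ (i j a b : Fin 5) → Dec (Interleaved K23⁺ i j a b)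
    interleaved? i j a b = (i <? a ×-dec a <? j ×-dec j <? b) ⊎-dec (a <? i ×-dec i <? b ×-dec b <? j)
    crossedBy? : ∀ i j a b → Dec (CrossedBy i j a b)
    crossedBy? i j a b = interleaved? i j a b →-dec edge? (lookup order i) (lookup order j) →-dec
                         edge? (lookup order a) (lookup order b) →-dec (a ≟ᶠ crossing₁ i j ×-dec b ≟ᶠ crossing₂ i j)

  order-uniqueCrossings : UniqueCrossings order
  order-uniqueCrossings i j a b a′ b′ _ _ _ ij ab a′b′ crosses crosses′ =
    trans (proj₁ ab-crossing) (sym (proj₁ a′b′-crossing)) , trans (proj₂ ab-crossing) (sym (proj₂ a′b′-crossing))
    where
    ab-crossing : a ≡ crossing₁ i j × b ≡ crossing₂ i j
    ab-crossing = crossedBy i j a b crosses ij ab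
    a′b′-crossing : a′ ≡ crossing₁ i j × b′ ≡ crossing₂ i j
    a′b′-crossing = crossedBy i j a′ b′ crosses′ ij a′b′

  K23⁺∈PH : InPH K23⁺
  K23⁺∈PH =
    (λ S block → inj₂ (covering-cycle⇒hamCycle order order-cycle (order-covers S (block⇒⊤⊆ S block)) (s≤s (s≤s (s≤s z≤n))))) ,
    (λ S block → covers⇒pseudoOuterplanar order (order-covers S (block⇒⊤⊆ S block)) order-uniqueCrossings)

theorem2p9 : ((n : ℕ) (G : Graph n) → ¬ HasMinor K23 G → InPH G)
             × Σ ℕ (λ n → Σ (Graph n) (λ G → InPH G × HasMinor K23 G))
theorem2p9 = K23-free⇒InPH , (5 , K23WithChord.K23⁺ , K23WithChord.K23⁺∈PH , K23WithChord.K23⁺-minor)
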